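{- Let $M$ be a cubic subsection, of dimensions $h\times h\times h$, of a $3$-dimensional binary image, let $b$ be a positive integer, and let $\hat P_M$ denote the number of boundary voxels in $M$. If $M$ contains at least $b$ voxels of value $0$ and at least $b$ voxels of value $1$, then $\hat P_M=\Omega(b^{2/3})$.
   Context: A $3$-dimensional binary image assigns to each voxel (an integer triple) a value in $\{0,1\}$. Two distinct voxels are adjacent if they differ by at most $1$ in each coordinate; a voxel is a boundary voxel if it has an adjacent voxel with a different value. -}

module Defs where

open import Data.Bool using (Bool; true; false; not; _xor_)
open import Data.Nat using (ℕ; zero; suc)
open import Data.Integer using (ℤ; +_; -[1+_]; _+_)
open import Data.List using (List; []; _∷_; concatMap; map; upTo)
open import Data.Bool.ListAction using (any)
open import Data.Product using (_×_; _,_)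

-- A voxel is an integer triple; a 3-dimensional binary image assigns
-- a value in {0,1} (encoded as Bool: false = 0, true = 1) to each voxel.
Voxel : Set
Voxel = ℤ × ℤ × ℤ

Image : Set
Image = Voxel → Bool

_+ᵥ_ : Voxel → Voxel → Voxel
(a , b , c) +ᵥ (x , y , z) = (a + x , b + y , c + z)

steps : List ℤ
steps = -[1+ 0 ] ∷ + 0 ∷ + 1 ∷ []

isZeroStep : ℤ → Bool
isZeroStep (+ zero) = true
isZeroStep _        = false

nonZeroOffset : Voxel → Bool
nonZeroOffset (a , b , c) = not (isZeroStep a Data.Bool.∧ isZeroStep b Data.Bool.∧ isZeroStep c)

offsets : List Voxel
offsets = concatMap (λ a → concatMap (λ b → concatMap (λ c →
  if nonZeroOffset (a , b , c) then (a , b , c) ∷ [] else []) steps) steps) steps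
  where open import Data.Bool using (if_then_else_)

adjacent : Voxel → List Voxel
adjacent v = map (v +ᵥ_) offsets

isBoundary : Image → Voxel → Bool
isBoundary f v = any (λ w → f w xor f v) (adjacent v)

cube : Voxel → ℕ → List Voxel
cube c h = concatMap (λ i → concatMap (λ j → map (λ k →
  c +ᵥ (+ i , + j , + k)) (upTo h)) (upTo h)) (upTo h)

count : {A : Set} → (A → Bool) → List A → ℕ
count p []       = 0
count p (x ∷ xs) with p x
... | true  = suc (count p xs)
... | false = count p xs

boundaryCount : Image → Voxel → ℕ → ℕ
boundaryCount f c h = count (isBoundary f) (cube c h)

onesCount : Image → Voxel → ℕ → ℕ
onesCount f c h = count f (cube c h)

zerosCount : Image → Voxel → ℕ → ℕ
zerosCount f c h = count (λ v → not (f v)) (cube c h)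

module Submission where

-- Only one property of boundary voxels is used: wherever the image changes between
-- two voxels consecutive along an axis, the first of them is a boundary voxel.  The
-- argument is therefore developed for an abstract solid g : ℕ³ → Bool together with a
-- marking bd that "detects" its changes, and specialised to images at the end.

open import Defs
open import Data.Bool using (Bool; true; false; not; T; _xor_)
open import Data.Bool.Properties using () renaming (_≟_ to _≟ᵇ_)
open import Data.Nat using (ℕ; zero; suc; _+_; _*_; _^_; _≤_; _<_; z≤n; s≤s; z<s; s<s; _≤?_;
  anyUpTo?; allUpTo?)
open import Data.Nat.Properties using (≤-refl; ≤-trans; ≤-reflexive; <-≤-trans; <⇒≤; <⇒≱; ≰⇒>;
  +-mono-≤; +-monoʳ-≤; *-mono-≤; *-monoʳ-≤; *-monoˡ-≤; *-mono-<; *-cancelˡ-≤; m≤m+n; m≤n+m;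
  m≤n*m; n≤1+n; +-comm; +-identityʳ; *-identityˡ; *-identityʳ; *-zeroʳ; *-assoc; *-distribˡ-+;
  *-distribʳ-+; +-commutativeSemigroup; module ≤-Reasoning)
open import Data.Nat.Solver using (module +-*-Solver)
open import Algebra.Properties.CommutativeSemigroup +-commutativeSemigroup
  using () renaming (interchange to +-interchange)
import Data.Integer as ℤ
import Data.Integer.Properties as ℤᵖ
open import Data.List using (List; []; _∷_; _++_; map; concatMap; applyUpTo)
open import Data.List.Relation.Unary.Any.Properties using (any⁺; map⁺)
open import Data.Product using (_×_; _,_; proj₁; proj₂; ∃-syntax)
open import Data.Product.Properties using (≡-dec)
open import Data.List.Membership.DecPropositional (≡-dec ℤ._≟_ (≡-dec ℤ._≟_ ℤ._≟_))
  using (_∈_; _∈?_; lose)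
open import Data.Sum using (_⊎_; inj₁; inj₂; [_,_])
open import Data.Empty using (⊥; ⊥-elim)
open import Function using (_∘_)
open import Relation.Nullary using (¬_; Dec; yes; no; ¬?; _×-dec_)
open import Relation.Nullary.Decidable using (⌊_⌋; T?; toWitness; fromWitness; from-yes;
  decidable-stable)
open import Relation.Binary.PropositionalEquality using (_≡_; _≢_; refl; sym; trans; cong; cong₂;
  subst; module ≡-Reasoning)
open +-*-Solver using (solve; _:+_; _:*_; _:=_; con)

𝟙 : Bool → ℕ
𝟙 true  = 1
𝟙 false = 0

𝟙-mono : ∀ {a b} → (T a → T b) → 𝟙 a ≤ 𝟙 b
𝟙-mono {false}         _   = z≤n
𝟙-mono {true}  {true}  _   = ≤-refl
𝟙-mono {true}  {false} a⇒b = ⊥-elim (a⇒b _)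

𝟙-∨ : ∀ {a b c} → (T a → T b ⊎ T c) → 𝟙 a ≤ 𝟙 b + 𝟙 c
𝟙-∨ {false} _ = z≤n
𝟙-∨ {true} {true} _ = s≤s z≤n
𝟙-∨ {true} {false} {true} _ = ≤-refl
𝟙-∨ {true} {false} {false} a⇒b∨c with a⇒b∨c _
... | inj₁ ()
... | inj₂ ()

𝟙-∧ : ∀ {a b c} → (T a → T b × T c) → 𝟙 a ≤ 𝟙 b * 𝟙 c
𝟙-∧ {false} _ = z≤n
𝟙-∧ {true} {true}  {true}  _     = ≤-refl
𝟙-∧ {true} {false}         a⇒b∧c = ⊥-elim (proj₁ (a⇒b∧c _))
𝟙-∧ {true} {true}  {false} a⇒b∧c = ⊥-elim (proj₂ (a⇒b∧c _))

𝟙-not : ∀ b → 𝟙 b + 𝟙 (not b) ≡ 1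
𝟙-not true  = refl
𝟙-not false = refl

sumTo : ℕ → (ℕ → ℕ) → ℕ
sumTo zero    f = 0
sumTo (suc n) f = f 0 + sumTo n (f ∘ suc)

syntax sumTo n (λ i → e) = ∑[ i < n ] e

sum-cong : ∀ n {f g : ℕ → ℕ} → (∀ {i} → i < n → f i ≡ g i) → sumTo n f ≡ sumTo n g
sum-cong zero    f≗g = refl
sum-cong (suc n) f≗g = cong₂ _+_ (f≗g z<s) (sum-cong n (λ i<n → f≗g (s<s i<n)))

sum-mono : ∀ n {f g : ℕ → ℕ} → (∀ {i} → i < n → f i ≤ g i) → sumTo n f ≤ sumTo n g
sum-mono zero    f≤g = z≤n
sum-mono (suc n) f≤g = +-mono-≤ (f≤g z<s) (sum-mono n (λ i<n → f≤g (s<s i<n)))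

sum-+ : ∀ n (f g : ℕ → ℕ) → ∑[ i < n ] (f i + g i) ≡ sumTo n f + sumTo n g
sum-+ zero    f g = refl
sum-+ (suc n) f g = begin
  (f 0 + g 0) + ∑[ i < n ] (f (suc i) + g (suc i))
    ≡⟨ cong ((f 0 + g 0) +_) (sum-+ n (f ∘ suc) (g ∘ suc)) ⟩
  (f 0 + g 0) + (sumTo n (f ∘ suc) + sumTo n (g ∘ suc))
    ≡⟨ +-interchange (f 0) (g 0) _ _ ⟩
  (f 0 + sumTo n (f ∘ suc)) + (g 0 + sumTo n (g ∘ suc)) ∎
  where open ≡-Reasoning

sum-const : ∀ n c → ∑[ i < n ] c ≡ n * c
sum-const zero    c = refl
sum-const (suc n) c = cong (c +_) (sum-const n c)

sum-*ˡ : ∀ n c (f : ℕ → ℕ) → ∑[ i < n ] (c * f i) ≡ c * sumTo n f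
sum-*ˡ zero    c f = sym (*-zeroʳ c)
sum-*ˡ (suc n) c f =
  trans (cong (c * f 0 +_) (sum-*ˡ n c (f ∘ suc))) (sym (*-distribˡ-+ c (f 0) _))

sum-*ʳ : ∀ n c (f : ℕ → ℕ) → ∑[ i < n ] (f i * c) ≡ sumTo n f * c
sum-*ʳ zero    c f = refl
sum-*ʳ (suc n) c f =
  trans (cong (f 0 * c +_) (sum-*ʳ n c (f ∘ suc))) (sym (*-distribʳ-+ c (f 0) _))

sum-product : ∀ n m (a b : ℕ → ℕ) → ∑[ j < n ] ∑[ k < m ] (a j * b k) ≡ sumTo n a * sumTo m b
sum-product n m a b = trans (sum-cong n (λ {j} _ → sum-*ˡ m (a j) b)) (sum-*ʳ n (sumTo m b) a)

sum-swap : ∀ n m (f : ℕ → ℕ → ℕ) → ∑[ i < n ] ∑[ j < m ] f i j ≡ ∑[ j < m ] ∑[ i < n ] f i j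
sum-swap zero    m f = sym (trans (sum-const m 0) (*-zeroʳ m))
sum-swap (suc n) m f = begin
  sumTo m (f 0) + ∑[ i < n ] ∑[ j < m ] f (suc i) j
    ≡⟨ cong (sumTo m (f 0) +_) (sum-swap n m (f ∘ suc)) ⟩
  sumTo m (f 0) + ∑[ j < m ] ∑[ i < n ] f (suc i) j
    ≡⟨ sum-+ m (f 0) (λ j → ∑[ i < n ] f (suc i) j) ⟨
  ∑[ j < m ] (f 0 j + ∑[ i < n ] f (suc i) j) ∎
  where open ≡-Reasoning

term≤sum : ∀ n (f : ℕ → ℕ) {i} → i < n → f i ≤ sumTo n f
term≤sum (suc n) f {zero}  _           = m≤m+n (f 0) _
term≤sum (suc n) f {suc i} (s<s i<n) = ≤-trans (term≤sum n (f ∘ suc) i<n) (m≤n+m _ (f 0))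

count≤ : ∀ n (p : ℕ → Bool) → ∑[ i < n ] 𝟙 (p i) ≤ n
count≤ n p = begin
  ∑[ i < n ] 𝟙 (p i) ≤⟨ sum-mono n (λ {i} _ → 𝟙-mono {p i} {true} _) ⟩
  ∑[ i < n ] 1       ≡⟨ sum-const n 1 ⟩
  n * 1              ≡⟨ *-identityʳ n ⟩
  n                  ∎
  where open ≤-Reasoning

count-all : ∀ n (p : ℕ → Bool) → (∀ {i} → i < n → T (p i)) → n ≤ ∑[ i < n ] 𝟙 (p i)
count-all n p all = begin
  n                  ≡⟨ *-identityʳ n ⟨
  n * 1              ≡⟨ sum-const n 1 ⟨
  ∑[ i < n ] 1       ≤⟨ sum-mono n (λ i<n → 𝟙-mono {true} (λ _ → all i<n)) ⟩
  ∑[ i < n ] 𝟙 (p i) ∎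
  where open ≤-Reasoning

square-reflects-≤ : ∀ x y → x * x ≤ y * y → x ≤ y
square-reflects-≤ x y x²≤y² with x ≤? y
... | yes x≤y = x≤y
... | no  x≰y = ⊥-elim (<⇒≱ (*-mono-< (≰⇒> x≰y) (≰⇒> x≰y)) x²≤y²)

-- If D·aᵢ² ≤ C·wᵢ² for all i < n then D·(∑ a)² ≤ C·(∑ w)²; with square roots this
-- is just the sum of √D·aᵢ ≤ √C·wᵢ.  Without them we argue by induction, comparing
-- the cross terms D·a₀·A ≤ C·w₀·W through their squares.
scaled-square-sum : ∀ n D C (a w : ℕ → ℕ) →
  (∀ {i} → i < n → D * (a i * a i) ≤ C * (w i * w i)) →
  D * (sumTo n a * sumTo n a) ≤ C * (sumTo n w * sumTo n w)
scaled-square-sum zero    D C a w _ = ≤-reflexive (trans (*-zeroʳ D) (sym (*-zeroʳ C)))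
scaled-square-sum (suc n) D C a w termwise = begin
  D * ((x + X) * (x + X))
    ≡⟨ expand D x X ⟩
  D * (x * x) + (2 * (D * (x * X)) + D * (X * X))
    ≤⟨ +-mono-≤ head (+-mono-≤ (*-monoʳ-≤ 2 cross) tail) ⟩
  C * (y * y) + (2 * (C * (y * Y)) + C * (Y * Y))
    ≡⟨ expand C y Y ⟨
  C * ((y + Y) * (y + Y)) ∎
  where
  open ≤-Reasoning
  x = a 0
  y = w 0
  X = sumTo n (a ∘ suc)
  Y = sumTo n (w ∘ suc)
  expand : ∀ D x X → D * ((x + X) * (x + X)) ≡ D * (x * x) + (2 * (D * (x * X)) + D * (X * X))
  expand = solve 3 (λ D x X → D :* ((x :+ X) :* (x :+ X))
                           := D :* (x :* x) :+ (con 2 :* (D :* (x :* X)) :+ D :* (X :* X))) refl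
  crossSquare : ∀ D x X → (D * (x * X)) * (D * (x * X)) ≡ (D * (x * x)) * (D * (X * X))
  crossSquare = solve 3 (λ D x X → (D :* (x :* X)) :* (D :* (x :* X))
                                := (D :* (x :* x)) :* (D :* (X :* X))) refl
  head : D * (x * x) ≤ C * (y * y)
  head = termwise z<s
  tail : D * (X * X) ≤ C * (Y * Y)
  tail = scaled-square-sum n D C (a ∘ suc) (w ∘ suc) (λ i<n → termwise (s<s i<n))
  cross : D * (x * X) ≤ C * (y * Y)
  cross = square-reflects-≤ _ _ (begin
    (D * (x * X)) * (D * (x * X)) ≡⟨ crossSquare D x X ⟩
    (D * (x * x)) * (D * (X * X)) ≤⟨ *-mono-≤ head tail ⟩
    (C * (y * y)) * (C * (Y * Y)) ≡⟨ crossSquare C y Y ⟨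
    (C * (y * Y)) * (C * (y * Y)) ∎)

sum-of-bounded-squares : ∀ n C (a w : ℕ → ℕ) → (∀ {i} → i < n → a i ≤ C) →
  (∀ {i} → i < n → a i ≤ w i * w i) → sumTo n a * sumTo n a ≤ C * (sumTo n w * sumTo n w)
sum-of-bounded-squares n C a w a≤C a≤w² = begin
  sumTo n a * sumTo n a       ≡⟨ *-identityˡ _ ⟨
  1 * (sumTo n a * sumTo n a) ≤⟨ scaled-square-sum n 1 C a w termwise ⟩
  C * (sumTo n w * sumTo n w) ∎
  where
  open ≤-Reasoning
  termwise : ∀ {i} → i < n → 1 * (a i * a i) ≤ C * (w i * w i)
  termwise i<n = ≤-trans (≤-reflexive (*-identityˡ _)) (*-mono-≤ (a≤C i<n) (a≤w² i<n))

-- if every wᵢ² exceeds W = ∑ w, then n² ≤ W: each wᵢ is at least √(W+1),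
-- so W ≥ n·√(W+1)
few-large-terms : ∀ n (w : ℕ → ℕ) → (∀ {i} → i < n → sumTo n w < w i * w i) →
  n * n ≤ sumTo n w
few-large-terms n w large = *-cancelˡ-≤ (suc W) (begin
  suc W * (n * n)                     ≡⟨ cong (λ m → suc W * (m * m)) n≡∑1 ⟩
  suc W * (sumTo n one * sumTo n one) ≤⟨ scaled-square-sum n (suc W) 1 one w termwise ⟩
  1 * (W * W)                         ≡⟨ *-identityˡ (W * W) ⟩
  W * W                               ≤⟨ *-monoˡ-≤ W (n≤1+n W) ⟩
  suc W * W                           ∎)
  where
  open ≤-Reasoning
  W = sumTo n w
  one : ℕ → ℕ
  one _ = 1
  n≡∑1 : n ≡ sumTo n one
  n≡∑1 = sym (trans (sum-const n 1) (*-identityʳ n))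
  termwise : ∀ {i} → i < n → suc W * (1 * 1) ≤ 1 * (w i * w i)
  termwise {i} i<n = begin
    suc W * (1 * 1) ≡⟨ *-identityʳ (suc W) ⟩
    suc W           ≤⟨ large i<n ⟩
    w i * w i       ≡⟨ *-identityˡ (w i * w i) ⟨
    1 * (w i * w i) ∎

AllOnes : ℕ → (ℕ → Bool) → Set
AllOnes n ℓ = ∀ {i} → i < n → T (ℓ i)

allOnes? : ∀ n ℓ → Dec (AllOnes n ℓ)
allOnes? n ℓ = allUpTo? (λ i → T? (ℓ i)) n

Mixed : ℕ → (ℕ → Bool) → Set
Mixed n ℓ = ¬ AllOnes n ℓ × ¬ AllOnes n (not ∘ ℓ)

mixed? : ∀ n ℓ → Dec (Mixed n ℓ)
mixed? n ℓ = ¬? (allOnes? n ℓ) ×-dec ¬? (allOnes? n (not ∘ ℓ))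

Detects : (ℓ d : ℕ → Bool) → Set
Detects ℓ d = ∀ x → ℓ x ≢ ℓ (suc x) → T (d x)

detects-not : ∀ {ℓ d} → Detects ℓ d → Detects (not ∘ ℓ) d
detects-not detects x change = detects x (change ∘ cong not)

T-not : ∀ {b} → T b → T (not b) → ⊥
T-not {true} _ ()

both⇒mixed : ∀ {n ℓ i j} → i < n → T (ℓ i) → j < n → T (not (ℓ j)) → Mixed n ℓ
both⇒mixed i<n on j<n off = (λ ones → T-not (ones j<n) off) , (λ zeros → T-not on (zeros i<n))

no-change⇒constant : ∀ {n} (ℓ : ℕ → Bool) → (∀ {x} → x < n → ℓ x ≡ ℓ (suc x)) →
  ∀ {i} → i ≤ n → ℓ i ≡ ℓ 0
no-change⇒constant ℓ steady {zero}  _     = refl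
no-change⇒constant ℓ steady {suc i} i+1≤n =
  trans (sym (steady i+1≤n)) (no-change⇒constant ℓ steady (<⇒≤ i+1≤n))

constant⇒uniform : ∀ {n} (ℓ : ℕ → Bool) → (∀ {i} → i < n → ℓ i ≡ ℓ 0) →
  AllOnes n ℓ ⊎ AllOnes n (not ∘ ℓ)
constant⇒uniform ℓ constant with ℓ 0
... | true  = inj₁ (λ i<n → subst T (sym (constant i<n)) _)
... | false = inj₂ (λ i<n → subst (T ∘ not) (sym (constant i<n)) _)

mixed⇒change : ∀ {n} (ℓ : ℕ → Bool) → Mixed n ℓ → ∃[ x ] (x < n × ℓ x ≢ ℓ (suc x))
mixed⇒change {n} ℓ (notOnes , notZeros) with anyUpTo? (λ x → ¬? (ℓ x ≟ᵇ ℓ (suc x))) n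
... | yes change  = change
... | no noChange = ⊥-elim ([ notOnes , notZeros ] (constant⇒uniform ℓ constant))
  where
  steady : ∀ {x} → x < n → ℓ x ≡ ℓ (suc x)
  steady x<n = decidable-stable (_ ≟ᵇ _) (λ change → noChange (_ , x<n , change))
  constant : ∀ {i} → i < n → ℓ i ≡ ℓ 0
  constant i<n = no-change⇒constant ℓ steady (<⇒≤ i<n)

mixed≤changes : ∀ n {ℓ d} → Detects ℓ d → 𝟙 ⌊ mixed? n ℓ ⌋ ≤ ∑[ x < n ] 𝟙 (d x)
mixed≤changes n {ℓ} {d} detects with mixed? n ℓ
... | no _      = z≤n
... | yes mixed with mixed⇒change ℓ mixed
... | x , x<n , change = ≤-trans (𝟙-mono (λ _ → detects x change)) (term≤sum n (𝟙 ∘ d) x<n)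

one⇒full-or-mixed : ∀ {n ℓ i} → i < n → T (ℓ i) → T ⌊ allOnes? n ℓ ⌋ ⊎ T ⌊ mixed? n ℓ ⌋
one⇒full-or-mixed {n} {ℓ} i<n on with allOnes? n ℓ
... | yes _       = inj₁ _
... | no notOnes = inj₂ (fromWitness (notOnes , λ zeros → T-not on (zeros i<n)))

-- A plane G is read on the square [0, h)²; its rows are G j and its columns column G k.
Plane : Set
Plane = ℕ → ℕ → Bool

column : Plane → ℕ → ℕ → Bool
column G k j = G j k

complement : Plane → Plane
complement G j k = not (G j k)

ones : ℕ → Plane → ℕ
ones h G = ∑[ j < h ] ∑[ k < h ] 𝟙 (G j k)

PlaneDetects : Plane → Plane → Set
PlaneDetects G D = (∀ j → Detects (G j) (D j)) × (∀ k → Detects (column G k) (column D k))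

complement-detects : ∀ {G D} → PlaneDetects G D → PlaneDetects (complement G) D
complement-detects (rows , columns) = (detects-not ∘ rows) , (detects-not ∘ columns)

ones≤area : ∀ h G → ones h G ≤ h * h
ones≤area h G = begin
  ones h G      ≤⟨ sum-mono h (λ {j} _ → count≤ h (G j)) ⟩
  ∑[ j < h ] h  ≡⟨ sum-const h h ⟩
  h * h         ∎
  where open ≤-Reasoning

mixedRows≤ : ∀ h {G D} → PlaneDetects G D → ∑[ j < h ] 𝟙 ⌊ mixed? h (G j) ⌋ ≤ ones h D
mixedRows≤ h (rows , _) = sum-mono h (λ {j} _ → mixed≤changes h (rows j))

mixedColumns≤ : ∀ h {G D} → PlaneDetects G D →
  ∑[ k < h ] 𝟙 ⌊ mixed? h (column G k) ⌋ ≤ ones h D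
mixedColumns≤ h {G} {D} (_ , columns) = begin
  ∑[ k < h ] 𝟙 ⌊ mixed? h (column G k) ⌋ ≤⟨ sum-mono h (λ {k} _ → mixed≤changes h (columns k)) ⟩
  ∑[ k < h ] ∑[ j < h ] 𝟙 (D j k)        ≡⟨ sum-swap h h (λ j k → 𝟙 (D j k)) ⟨
  ones h D                                ∎
  where open ≤-Reasoning

large-boundary : ∀ h G D → h ≤ ones h D → ones h G ≤ ones h D * ones h D
large-boundary h G D h≤β = ≤-trans (ones≤area h G) (*-mono-≤ h≤β h≤β)

-- with no all-ones row or column, every one lies on a mixed row and a mixed column,
-- so there are at most (mixed rows)·(mixed columns) ones
ones-without-full-lines : ∀ h {G D} → PlaneDetects G D →
  (∀ {j} → j < h → ¬ AllOnes h (G j)) → (∀ {k} → k < h → ¬ AllOnes h (column G k)) →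
  ones h G ≤ ones h D * ones h D
ones-without-full-lines h {G} {D} detects notFullRow notFullColumn = begin
  ones h G
    ≤⟨ sum-mono h (λ j<h → sum-mono h (λ k<h → 𝟙-∧ (on-mixed-lines j<h k<h))) ⟩
  ∑[ j < h ] ∑[ k < h ] (𝟙 ⌊ mixed? h (G j) ⌋ * 𝟙 ⌊ mixed? h (column G k) ⌋)
    ≡⟨ sum-product h h _ _ ⟩
  (∑[ j < h ] 𝟙 ⌊ mixed? h (G j) ⌋) * (∑[ k < h ] 𝟙 ⌊ mixed? h (column G k) ⌋)
    ≤⟨ *-mono-≤ (mixedRows≤ h detects) (mixedColumns≤ h detects) ⟩
  ones h D * ones h D ∎
  where
  open ≤-Reasoning
  on-mixed-lines : ∀ {j k} → j < h → k < h → T (G j k) →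
    T ⌊ mixed? h (G j) ⌋ × T ⌊ mixed? h (column G k) ⌋
  on-mixed-lines j<h k<h on =
    fromWitness (notFullRow j<h , λ zeros → T-not on (zeros k<h)) ,
    fromWitness (notFullColumn k<h , λ zeros → T-not on (zeros j<h))

-- If some line is all ones and some line
-- all zeros, they are parallel (crossing lines share a cell) and every line across
-- them is mixed, so β ≥ h.  Otherwise one colour has no full line.
plane-isoperimetry : ∀ h {G D} → PlaneDetects G D →
  ones h G ≤ ones h D * ones h D ⊎ ones h (complement G) ≤ ones h D * ones h D
plane-isoperimetry h {G} {D} detects
  with anyUpTo? (λ j → allOnes? h (G j)) h            | anyUpTo? (λ j → allOnes? h (complement G j)) h
     | anyUpTo? (λ k → allOnes? h (column G k)) h     | anyUpTo? (λ k → allOnes? h (column (complement G) k)) h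
... | yes (j₁ , j₁<h , ones₁) | yes (j₀ , j₀<h , zeros₀) | _ | _ =
  inj₁ (large-boundary h G D (≤-trans (count-all h _ columnMixed) (mixedColumns≤ h detects)))
  where
  columnMixed : ∀ {k} → k < h → T ⌊ mixed? h (column G k) ⌋
  columnMixed k<h = fromWitness (both⇒mixed j₁<h (ones₁ k<h) j₀<h (zeros₀ k<h))
... | _ | _ | yes (k₁ , k₁<h , ones₁) | yes (k₀ , k₀<h , zeros₀) =
  inj₁ (large-boundary h G D (≤-trans (count-all h _ rowMixed) (mixedRows≤ h detects)))
  where
  rowMixed : ∀ {j} → j < h → T ⌊ mixed? h (G j) ⌋
  rowMixed j<h = fromWitness (both⇒mixed k₁<h (ones₁ j<h) k₀<h (zeros₀ j<h))
... | yes (j₁ , j₁<h , ones₁) | _ | _ | yes (k₀ , k₀<h , zeros₀) =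
  ⊥-elim (T-not (ones₁ k₀<h) (zeros₀ j₁<h))
... | _ | yes (j₀ , j₀<h , zeros₀) | yes (k₁ , k₁<h , ones₁) | _ =
  ⊥-elim (T-not (ones₁ j₀<h) (zeros₀ k₁<h))
... | no noFullRow | _ | no noFullColumn | _ =
  inj₁ (ones-without-full-lines h detects (λ j<h full → noFullRow (_ , j<h , full))
                                          (λ k<h full → noFullColumn (_ , k<h , full)))
... | _ | no noEmptyRow | _ | no noEmptyColumn =
  inj₂ (ones-without-full-lines h (complement-detects detects)
          (λ j<h empty → noEmptyRow (_ , j<h , empty)) (λ k<h empty → noEmptyColumn (_ , k<h , empty)))

ones-complement : ∀ h G → ones h G + ones h (complement G) ≡ h * h
ones-complement h G = begin
  ones h G + ones h (complement G)
    ≡⟨ sum-+ h _ _ ⟨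
  ∑[ j < h ] (∑[ k < h ] 𝟙 (G j k) + ∑[ k < h ] 𝟙 (not (G j k)))
    ≡⟨ sum-cong h (λ {j} _ → sum-+ h _ _) ⟨
  ∑[ j < h ] ∑[ k < h ] (𝟙 (G j k) + 𝟙 (not (G j k)))
    ≡⟨ sum-cong h (λ {j} _ → sum-cong h (λ {k} _ → 𝟙-not (G j k))) ⟩
  ∑[ j < h ] ∑[ k < h ] 1
    ≡⟨ sum-cong h (λ _ → trans (sum-const h 1) (*-identityʳ h)) ⟩
  ∑[ j < h ] h
    ≡⟨ sum-const h h ⟩
  h * h ∎
  where open ≡-Reasoning

-- A solid g is read on the cube [0, h)³; g i is its i-th slice, a plane.
Solid : Set
Solid = ℕ → ℕ → ℕ → Bool

pillar : Solid → ℕ → ℕ → ℕ → Bool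
pillar g j k i = g i j k

invert : Solid → Solid
invert g i = complement (g i)

SolidDetects : Solid → Solid → Set
SolidDetects g bd = (∀ j k → Detects (pillar g j k) (pillar bd j k)) × (∀ i → PlaneDetects (g i) (bd i))

invert-detects : ∀ {g bd} → SolidDetects g bd → SolidDetects (invert g) bd
invert-detects (pillars , slices) = (λ j k → detects-not (pillars j k)) , (complement-detects ∘ slices)

minority : ∀ {s t B} → s ≤ 2 * B → 4 * B < s + t → s ≤ t
minority {s} {t} {B} s≤2B 4B<s+t with s ≤? t
... | yes s≤t = s≤t
... | no  s≰t = ⊥-elim (<⇒≱ 4B<s+t (begin
  s + t         ≤⟨ +-monoʳ-≤ s (<⇒≤ (≰⇒> s≰t)) ⟩
  s + s         ≤⟨ +-mono-≤ s≤2B s≤2B ⟩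
  2 * B + 2 * B ≡⟨ *-distribʳ-+ B 2 2 ⟨
  4 * B         ∎))
  where open ≤-Reasoning

colour-bound⇒64 : ∀ {n V B} → n ≤ V → V * V ≤ 2 * B * (B * B) → n * n ≤ 64 * (B * (B * B))
colour-bound⇒64 {n} {V} {B} n≤V V²≤2B³ = begin
  n * n               ≤⟨ *-mono-≤ n≤V n≤V ⟩
  V * V               ≤⟨ V²≤2B³ ⟩
  2 * B * (B * B)     ≡⟨ *-assoc 2 B (B * B) ⟩
  2 * (B * (B * B))   ≤⟨ *-monoˡ-≤ (B * (B * B)) {2} {64} (s≤s (s≤s z≤n)) ⟩
  64 * (B * (B * B))  ∎
  where open ≤-Reasoning

module Cube (h : ℕ) where

  volume : Solid → ℕ
  volume g = ∑[ i < h ] ones h (g i)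

  fullPillars mixedPillars : Solid → ℕ
  fullPillars  g = ∑[ j < h ] ∑[ k < h ] 𝟙 ⌊ allOnes? h (pillar g j k) ⌋
  mixedPillars g = ∑[ j < h ] ∑[ k < h ] 𝟙 ⌊ mixed? h (pillar g j k) ⌋

  -- a full pillar meets every slice in a one
  full≤slice : ∀ g {i} → i < h → fullPillars g ≤ ones h (g i)
  full≤slice g i<h = sum-mono h (λ _ → sum-mono h (λ _ → 𝟙-mono (λ full → toWitness full i<h)))

  -- a one of a slice lies on a full or on a mixed pillar
  slice≤full+mixed : ∀ g {i} → i < h → ones h (g i) ≤ fullPillars g + mixedPillars g
  slice≤full+mixed g i<h = begin
    ones h (g _)
      ≤⟨ sum-mono h (λ _ → sum-mono h (λ _ → 𝟙-∨ (one⇒full-or-mixed i<h))) ⟩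
    ∑[ j < h ] ∑[ k < h ] (𝟙 ⌊ allOnes? h (pillar g j k) ⌋ + 𝟙 ⌊ mixed? h (pillar g j k) ⌋)
      ≡⟨ sum-cong h (λ _ → sum-+ h _ _) ⟩
    ∑[ j < h ] (∑[ k < h ] 𝟙 ⌊ allOnes? h (pillar g j k) ⌋ + ∑[ k < h ] 𝟙 ⌊ mixed? h (pillar g j k) ⌋)
      ≡⟨ sum-+ h _ _ ⟩
    fullPillars g + mixedPillars g ∎
    where open ≤-Reasoning

  -- every mixed pillar contains a detected change
  mixed≤boundary : ∀ {g bd} → SolidDetects g bd → mixedPillars g ≤ volume bd
  mixed≤boundary {g} {bd} (pillars , _) = begin
    mixedPillars g
      ≤⟨ sum-mono h (λ {j} _ → sum-mono h (λ {k} _ → mixed≤changes h (pillars j k))) ⟩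
    ∑[ j < h ] ∑[ k < h ] ∑[ i < h ] 𝟙 (bd i j k)
      ≡⟨ sum-cong h (λ {j} _ → sum-swap h h (λ k i → 𝟙 (bd i j k))) ⟩
    ∑[ j < h ] ∑[ i < h ] ∑[ k < h ] 𝟙 (bd i j k)
      ≡⟨ sum-swap h h (λ j i → ∑[ k < h ] 𝟙 (bd i j k)) ⟩
    volume bd ∎
    where open ≤-Reasoning

  -- If the cube is large (4B < h²) and few pillars are full (at most B), then the
  -- ones number at most 2B·B²: each slice has at most 2B ones, hence is the minority
  -- colour of its slice, hence has at most βᵢ² ones by plane isoperimetry.
  few-full-pillars : ∀ {g bd} → SolidDetects g bd → 4 * volume bd < h * h →
    fullPillars g ≤ volume bd → volume g * volume g ≤ 2 * volume bd * (volume bd * volume bd)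
  few-full-pillars {g} {bd} detects large few =
    sum-of-bounded-squares h (2 * B) (ones h ∘ g) (ones h ∘ bd) slice≤2B slice≤β²
    where
    B = volume bd
    slice≤2B : ∀ {i} → i < h → ones h (g i) ≤ 2 * B
    slice≤2B i<h = begin
      ones h (g _)                   ≤⟨ slice≤full+mixed g i<h ⟩
      fullPillars g + mixedPillars g ≤⟨ +-mono-≤ few (mixed≤boundary detects) ⟩
      B + B                          ≡⟨ cong (B +_) (+-identityʳ B) ⟨
      2 * B                          ∎
      where open ≤-Reasoning
    slice≤β² : ∀ {i} → i < h → ones h (g i) ≤ ones h (bd i) * ones h (bd i)
    slice≤β² {i} i<h with plane-isoperimetry h (proj₂ detects i)
    ... | inj₁ ones≤β² = ones≤β²
    ... | inj₂ zeros≤β² = ≤-trans (minority {B = B} (slice≤2B i<h) large′) zeros≤β²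
      where
      large′ : 4 * B < ones h (g i) + ones h (complement (g i))
      large′ = ≤-trans large (≤-reflexive (sym (ones-complement h (g i))))

  -- If both colours have more than B full pillars, every slice has more than B
  -- cells of each colour, so βᵢ² > B for each slice and h² ≤ B.
  many-full-pillars : ∀ {g bd} → SolidDetects g bd → volume bd < fullPillars g →
    volume bd < fullPillars (invert g) → h * h ≤ volume bd
  many-full-pillars {g} {bd} detects manyOnes manyZeros = few-large-terms h (ones h ∘ bd) β²-large
    where
    β²-large : ∀ {i} → i < h → volume bd < ones h (bd i) * ones h (bd i)
    β²-large {i} i<h with plane-isoperimetry h (proj₂ detects i)
    ... | inj₁ ones≤β²  = <-≤-trans (<-≤-trans manyOnes (full≤slice g i<h)) ones≤β²
    ... | inj₂ zeros≤β² = <-≤-trans (<-≤-trans manyZeros (full≤slice (invert g) i<h)) zeros≤β²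

  volume≤ : ∀ g → volume g ≤ h * (h * h)
  volume≤ g = ≤-trans (sum-mono h (λ {i} _ → ones≤area h (g i))) (≤-reflexive (sum-const h (h * h)))

  -- a small cube (h² ≤ 4B) has at most h³ ≤ (4B)^{3/2} cells
  small-cube : ∀ {g} n B → h * h ≤ 4 * B → n ≤ volume g → n * n ≤ 64 * (B * (B * B))
  small-cube {g} n B small n≤ones = begin
    n * n                          ≤⟨ *-mono-≤ n≤h³ n≤h³ ⟩
    (h * (h * h)) * (h * (h * h))  ≡⟨ cube-square h ⟩
    (h * h) * ((h * h) * (h * h))  ≤⟨ *-mono-≤ small (*-mono-≤ small small) ⟩
    (4 * B) * ((4 * B) * (4 * B))  ≡⟨ cube-4 B ⟩
    64 * (B * (B * B))             ∎
    where
    open ≤-Reasoning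
    n≤h³ : n ≤ h * (h * h)
    n≤h³ = ≤-trans n≤ones (volume≤ g)
    cube-square : ∀ h → (h * (h * h)) * (h * (h * h)) ≡ (h * h) * ((h * h) * (h * h))
    cube-square = solve 1 (λ h → (h :* (h :* h)) :* (h :* (h :* h)) := (h :* h) :* ((h :* h) :* (h :* h))) refl
    cube-4 : ∀ B → (4 * B) * ((4 * B) * (4 * B)) ≡ 64 * (B * (B * B))
    cube-4 = solve 1 (λ B → (con 4 :* B) :* ((con 4 :* B) :* (con 4 :* B)) := con 64 :* (B :* (B :* B))) refl

  -- A small cube is
  -- handled by counting; in a large one, a colour with few full pillars has at most
  -- √(2B)·B cells, and the two colours cannot both have many full pillars.
  cube-isoperimetry : ∀ {g bd} n → SolidDetects g bd → n ≤ volume g → n ≤ volume (invert g) →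
    n * n ≤ 64 * (volume bd * (volume bd * volume bd))
  cube-isoperimetry {g} {bd} n detects n≤ones n≤zeros with h * h ≤? 4 * volume bd
  ... | yes small = small-cube n (volume bd) small n≤ones
  ... | no large with fullPillars g ≤? volume bd | fullPillars (invert g) ≤? volume bd
  ...   | yes few | _       =
    colour-bound⇒64 {B = volume bd} n≤ones (few-full-pillars detects (≰⇒> large) few)
  ...   | no _    | yes few =
    colour-bound⇒64 {B = volume bd} n≤zeros (few-full-pillars (invert-detects detects) (≰⇒> large) few)
  ...   | no many | no many′ =
    ⊥-elim (large (≤-trans (many-full-pillars detects (≰⇒> many) (≰⇒> many′)) (m≤n*m (volume bd) 4)))

module Images where

  open import Data.Integer using (+_)

  -- The cube is enumerated by nested concatMaps over upTo h; counting along such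
  -- lists turns them into nested finite sums.
  count-++ : ∀ {A : Set} (p : A → Bool) xs ys → count p (xs ++ ys) ≡ count p xs + count p ys
  count-++ p []       ys = refl
  count-++ p (x ∷ xs) ys with p x
  ... | true  = cong suc (count-++ p xs ys)
  ... | false = count-++ p xs ys

  count-concatMap : ∀ {A B : Set} (p : B → Bool) (F : A → List B) n (G : ℕ → A) →
    count p (concatMap F (applyUpTo G n)) ≡ ∑[ i < n ] count p (F (G i))
  count-concatMap p F zero    G = refl
  count-concatMap p F (suc n) G =
    trans (count-++ p (F (G 0)) _) (cong (λ m → count p (F (G 0)) + m) (count-concatMap p F n (G ∘ suc)))

  count-map : ∀ {A B : Set} (p : B → Bool) (F : A → B) n (G : ℕ → A) →
    count p (map F (applyUpTo G n)) ≡ ∑[ i < n ] 𝟙 (p (F (G i)))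
  count-map p F zero    G = refl
  count-map p F (suc n) G with p (F (G 0))
  ... | true  = cong suc (count-map p F n (G ∘ suc))
  ... | false = count-map p F n (G ∘ suc)

  solid : (Voxel → Bool) → Voxel → Solid
  solid f c i j k = f (c +ᵥ (+ i , + j , + k))

  count-cube : ∀ (p : Voxel → Bool) c h → count p (cube c h) ≡ Cube.volume h (solid p c)
  count-cube p c h = trans (count-concatMap p _ h (λ i → i))
    (sum-cong h (λ _ → trans (count-concatMap p _ h (λ j → j)) (sum-cong h (λ _ → count-map p _ h (λ k → k)))))

  xor-≢ : ∀ {a b} → a ≢ b → T (b xor a)
  xor-≢ {true}  {true}  a≢b = a≢b refl
  xor-≢ {true}  {false} _   = _
  xor-≢ {false} {true}  _   = _
  xor-≢ {false} {false} a≢b = a≢b refl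

  change⇒boundary : ∀ f v {o} → o ∈ offsets → f v ≢ f (v +ᵥ o) → T (isBoundary f v)
  change⇒boundary f v o∈offsets change =
    any⁺ (λ w → f w xor f v) (map⁺ {f = v +ᵥ_} (lose o∈offsets (xor-≢ change)))

  step : ∀ c p o q → p +ᵥ o ≡ q → (c +ᵥ p) +ᵥ o ≡ c +ᵥ q
  step (a , b , d) (x , y , z) (u , v , w) _ refl =
    cong₂ _,_ (ℤᵖ.+-assoc a x u) (cong₂ _,_ (ℤᵖ.+-assoc b y v) (ℤᵖ.+-assoc d z w))

  next : ∀ i → + i ℤ.+ + 1 ≡ + suc i
  next i = cong +_ (+-comm i 1)

  stay : ∀ i → + i ℤ.+ + 0 ≡ + i
  stay i = cong +_ (+-identityʳ i)

  e₁ e₂ e₃ : Voxel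
  e₁ = (+ 1 , + 0 , + 0)
  e₂ = (+ 0 , + 1 , + 0)
  e₃ = (+ 0 , + 0 , + 1)

  e₁∈offsets : e₁ ∈ offsets
  e₁∈offsets = from-yes (e₁ ∈? offsets)

  e₂∈offsets : e₂ ∈ offsets
  e₂∈offsets = from-yes (e₂ ∈? offsets)

  e₃∈offsets : e₃ ∈ offsets
  e₃∈offsets = from-yes (e₃ ∈? offsets)

  boundary-detects : ∀ f c → SolidDetects (solid f c) (solid (isBoundary f) c)
  boundary-detects f c = pillars , λ i → rows i , columns i
    where
    g bd : Solid
    g  = solid f c
    bd = solid (isBoundary f) c
    along : ∀ {p q} o → o ∈ offsets → p +ᵥ o ≡ q → f (c +ᵥ p) ≢ f (c +ᵥ q) → T (isBoundary f (c +ᵥ p))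
    along {p} o o∈offsets p+o≡q change =
      change⇒boundary f (c +ᵥ p) o∈offsets (λ same → change (trans same (cong f (step c p o _ p+o≡q))))
    pillars : ∀ j k → Detects (pillar g j k) (pillar bd j k)
    pillars j k x = along e₁ e₁∈offsets (cong₂ _,_ (next x) (cong₂ _,_ (stay j) (stay k)))
    rows : ∀ i j → Detects (g i j) (bd i j)
    rows i j x = along e₃ e₃∈offsets (cong₂ _,_ (stay i) (cong₂ _,_ (stay j) (next x)))
    columns : ∀ i k → Detects (column (g i) k) (column (bd i) k)
    columns i k x = along e₂ e₂∈offsets (cong₂ _,_ (stay i) (cong₂ _,_ (next x) (stay k)))

open Images using (solid; count-cube; boundary-detects)

mainTheorem11 : ∃[ K ] ((f : Image) (c : Voxel) (h b : ℕ) → 1 ≤ b →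
                  b ≤ zerosCount f c h → b ≤ onesCount f c h →
                  b ^ 2 ≤ K * boundaryCount f c h ^ 3)
mainTheorem11 = 64 , isoperimetry
  where
  isoperimetry : (f : Image) (c : Voxel) (h b : ℕ) → 1 ≤ b →
    b ≤ zerosCount f c h → b ≤ onesCount f c h → b ^ 2 ≤ 64 * boundaryCount f c h ^ 3
  isoperimetry f c h b _ b≤zeros b≤ones = begin
    b ^ 2              ≡⟨ cong (b *_) (*-identityʳ b) ⟩
    b * b              ≤⟨ Cube.cube-isoperimetry h b (boundary-detects f c) b≤ones′ b≤zeros′ ⟩
    64 * (B * (B * B)) ≡⟨ cong (λ m → 64 * (B * (B * m))) (*-identityʳ B) ⟨
    64 * B ^ 3         ≡⟨ cong (λ m → 64 * m ^ 3) (count-cube (isBoundary f) c h) ⟨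
    64 * boundaryCount f c h ^ 3 ∎
    where
    open ≤-Reasoning
    B = Cube.volume h (solid (isBoundary f) c)
    b≤ones′ : b ≤ Cube.volume h (solid f c)
    b≤ones′ = subst (b ≤_) (count-cube f c h) b≤ones
    b≤zeros′ : b ≤ Cube.volume h (invert (solid f c))
    b≤zeros′ = subst (b ≤_) (count-cube (not ∘ f) c h) b≤zeros
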